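{- Let $K$ be a field with a non-Archimedean valuation $\mathrm{val}$, let $\mu$ be a valuated matroid on $[n]$ with tropical linear space $\overline{\operatorname{trop}}(\mu)\subseteq\mathbb{P}(\mathbb{T}^n)$, and let $A\in K^{m\times n}$. Then the set $\mathrm{val}(A)\odot\overline{\operatorname{trop}}(\mu)=\{\mathrm{val}(A)\odot x : x\in\overline{\operatorname{trop}}(\mu)\}$ is tropically convex: for all $\tilde v,\tilde w$ in it and all $\lambda,\rho\in\mathbb{R}$, the vector $(\lambda\odot\tilde v)\oplus(\rho\odot\tilde w)$ (coordinatewise $\min(\lambda+\tilde v_i,\rho+\tilde w_i)$) lies in it.
   Context: $\mathbb{T}=\mathbb{R}\cup\{\infty\}$, $\oplus=\min$, $\odot=+$. A valuated matroid of rank $r$ on $[n]$ is $\mu:\binom{[n]}{r}\to\mathbb{T}$, not identically $\infty$, such that for all $I,J\in\binom{[n]}{r}$, $i\in I\setminus J$ there is $j\in J\setminus I$ with $\mu(I)+\mu(J)\ge\mu((I\setminus i)\cup j)+\mu((J\setminus j)\cup i)$. Its tropical linear space $\overline{\operatorname{trop}}(\mu)$ is the set of $x\in\mathbb{T}^n$ (not all $\infty$, up to adding multiples of $(1,\dots,1)$) such that for every valuated circuit $C$ the minimum $\min_i(C_i+x_i)$ is attained at least twice (or equals $\infty$); the valuated circuits are the vectors $C(I)$, $I\in\binom{[n]}{r+1}$, with $C(I)_i=\mu(I\setminus i)$ for $i\in I$ and $\infty$ otherwise, not identically $\infty$. $\mathrm{val}(A)$ is entrywise, and $(\mathrm{val}(A)\odot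 x)_i=\min_j(\mathrm{val}(A_{ij})+x_j)$. -}

module Defs where

open import Level using (Level; _⊔_) renaming (suc to lsuc)
open import Data.Nat using (ℕ) renaming (suc to nsuc)
import Data.Fin as Fin
open Fin using (Fin)
open import Data.Fin.Subset using (Subset; _∈_; _∉_; ∣_∣; _∪_; ⁅_⁆; _-_)
open import Data.Fin.Subset.Properties using (_∈?_)
open import Relation.Nullary using (Dec; yes; no)
open import Data.Product using (Σ; ∃; _×_; _,_)
open import Data.Sum using (_⊎_; inj₁; inj₂)
open import Relation.Nullary using (¬_)
open import Relation.Binary.PropositionalEquality using (_≡_)
open import Algebra.Bundles using (CommutativeRing)

-- The real numbers, axiomatised as a Dedekind-complete ordered field
-- (any model of this record is isomorphic to ℝ).

record Reals : Set₁ where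
  infixl 6 _+_
  infixl 7 _*_
  infix 4 _≤_
  field
    ℝ    : Set
    _+_  : ℝ → ℝ → ℝ
    _*_  : ℝ → ℝ → ℝ
    -_   : ℝ → ℝ
    0r   : ℝ
    1r   : ℝ
    _≤_  : ℝ → ℝ → Set
    +-assoc  : ∀ x y z → (x + y) + z ≡ x + (y + z)
    +-comm   : ∀ x y → x + y ≡ y + x
    +-idʳ    : ∀ x → x + 0r ≡ x
    +-invʳ   : ∀ x → x + (- x) ≡ 0r
    *-assoc  : ∀ x y z → (x * y) * z ≡ x * (y * z)
    *-comm   : ∀ x y → x * y ≡ y * x
    *-idʳ    : ∀ x → x * 1r ≡ x
    distrib  : ∀ x y z → x * (y + z) ≡ (x * y) + (x * z)
    0≢1      : ¬ (0r ≡ 1r)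
    *-inv    : ∀ x → ¬ (x ≡ 0r) → ∃ λ y → x * y ≡ 1r
    ≤-refl   : ∀ x → x ≤ x
    ≤-trans  : ∀ {x y z} → x ≤ y → y ≤ z → x ≤ z
    ≤-antisym : ∀ {x y} → x ≤ y → y ≤ x → x ≡ y
    ≤-total  : ∀ x y → x ≤ y ⊎ y ≤ x
    +-mono   : ∀ {x y} z → x ≤ y → x + z ≤ y + z
    *-nonneg : ∀ {x y} → 0r ≤ x → 0r ≤ y → 0r ≤ x * y
    complete : (S : ℝ → Set) → (∃ λ x → S x) → (∃ λ b → ∀ x → S x → x ≤ b) →
               ∃ λ s → (∀ x → S x → x ≤ s) × (∀ b → (∀ x → S x → x ≤ b) → s ≤ b)

record Field (c ℓ : Level) : Set (lsuc (c ⊔ ℓ)) where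
  field
    commutativeRing : CommutativeRing c ℓ
  open CommutativeRing commutativeRing public
  field
    0≉1 : ¬ (0# ≈ 1#)
    inv : ∀ x → ¬ (x ≈ 0#) → ∃ λ y → x * y ≈ 1#

module Tropical (RR : Reals) where
  open Reals RR

  data 𝕋 : Set where
    fin : ℝ → 𝕋
    ∞   : 𝕋

  infixl 6 _⊙_
  infixl 5 _⊕_
  infix 4 _≤T_

  _⊙_ : 𝕋 → 𝕋 → 𝕋
  fin a ⊙ fin b = fin (a + b)
  fin a ⊙ ∞     = ∞
  ∞     ⊙ _     = ∞

  data _≤T_ : 𝕋 → 𝕋 → Set where
    fin≤fin : ∀ {a b} → a ≤ b → fin a ≤T fin b
    _≤∞     : ∀ x → x ≤T ∞

  _⊕_ : 𝕋 → 𝕋 → 𝕋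
  fin a ⊕ fin b with ≤-total a b
  ... | inj₁ _ = fin a
  ... | inj₂ _ = fin b
  fin a ⊕ ∞ = fin a
  ∞ ⊕ y = y

  ⨁ : (n : ℕ) → (Fin n → 𝕋) → 𝕋
  ⨁ ℕ.zero    f = ∞
  ⨁ (nsuc n)  f = f Fin.zero ⊕ ⨁ n (λ j → f (Fin.suc j))

  _⊙ᴹ_ : ∀ {m n} → (Fin m → Fin n → 𝕋) → (Fin n → 𝕋) → (Fin m → 𝕋)
  _⊙ᴹ_ {n = n} M x i = ⨁ n (λ j → M i j ⊙ x j)

  -- Valuated matroids.  A map μ : binom([n], r) → 𝕋 is encoded as a map
  -- on all subsets of [n] that is ∞ on subsets of size ≠ r.

  record ValuatedMatroid (n r : ℕ) : Set where
    field
      μ        : Subset n → 𝕋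
      μ-size   : ∀ I → ¬ (∣ I ∣ ≡ r) → μ I ≡ ∞
      nontriv  : ∃ λ I → ∣ I ∣ ≡ r × ∃ λ a → μ I ≡ fin a
      exchange : ∀ I J → ∣ I ∣ ≡ r → ∣ J ∣ ≡ r → ∀ i → i ∈ I → i ∉ J →
                 ∃ λ j → j ∈ J × j ∉ I ×
                   (μ ((I - i) ∪ ⁅ j ⁆) ⊙ μ ((J - j) ∪ ⁅ i ⁆) ≤T μ I ⊙ μ J)

  circuitVec : ∀ {n} → (Subset n → 𝕋) → Subset n → Fin n → 𝕋
  circuitVec μ I i = μI∖i-if-member (i ∈? I)
    where
    μI∖i-if-member : Dec (i ∈ I) → 𝕋
    μI∖i-if-member (yes _) = μ (I - i)
    μI∖i-if-member (no _)  = ∞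

  NotAllInfinite : ∀ {n} → (Fin n → 𝕋) → Set
  NotAllInfinite {n} v = ∃ λ i → ∃ λ a → v i ≡ fin a

  MinTwiceOrInf : ∀ {n} → (Fin n → 𝕋) → Set
  MinTwiceOrInf {n} v =
    (∃ λ i → ∃ λ j → ¬ (i ≡ j) × v i ≡ v j × (∀ k → v i ≤T v k))
    ⊎ (∀ k → v k ≡ ∞)

  -- the set of representatives in 𝕋ⁿ of points of trop(μ) ⊆ ℙ(𝕋ⁿ)
  -- (the condition is invariant under adding multiples of (1,…,1))
  InTrop : ∀ {n r} → ValuatedMatroid n r → (Fin n → 𝕋) → Set
  InTrop {n} {r} M x =
    NotAllInfinite x ×
    (∀ (I : Subset n) → ∣ I ∣ ≡ nsuc r →
       NotAllInfinite (circuitVec μ I) →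
       MinTwiceOrInf (λ k → circuitVec μ I k ⊙ x k))
    where open ValuatedMatroid M

module _ (RR : Reals) where
  open Tropical RR

  record Valuation {c ℓ} (K : Field c ℓ) : Set (c ⊔ ℓ) where
    open Field K
    field
      val      : Carrier → 𝕋
      val-cong : ∀ {x y} → x ≈ y → val x ≡ val y
      val-∞    : ∀ x → (val x ≡ ∞ → x ≈ 0#) × (x ≈ 0# → val x ≡ ∞)
      val-*    : ∀ x y → val (x * y) ≡ val x ⊙ val y
      val-+    : ∀ x y → (val x ⊕ val y) ≤T val (x + y)

{-# OPTIONS --safe #-}
-- Scaling a vector by a tropical scalar does not move the positions where its
-- minimum is attained, and the minimum of u ⊕ w is attained twice as soon as the
-- smaller of the minima of u and w is; hence the circuit conditions defining a
-- tropical linear space are preserved by λ ⊙ x ⊕ ρ ⊙ y.  Since x ↦ B ⊙ x is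
-- tropically linear for every matrix B, the image of this convex set is convex;
-- the field and the valuation only serve to produce B = val(A).
module Submission where

open import Defs
open import Data.Nat using (ℕ; zero; suc)
open import Data.Fin using (Fin)
open import Data.Fin.Subset using (∣_∣)
open import Data.Product using (∃; _×_; _,_)
open import Data.Sum using (_⊎_; inj₁; inj₂)
open import Relation.Nullary using (¬_)
open import Relation.Binary.PropositionalEquality
  using (_≡_; refl; sym; trans; cong; cong₂; subst₂; isEquivalence; module ≡-Reasoning)
open import Algebra.Bundles using (CommutativeSemigroup)
import Algebra.Properties.CommutativeSemigroup as CommutativeSemigroupProperties

module TropicalProperties (RR : Reals) where
  open Reals RR using (ℝ; ≤-refl; ≤-trans; ≤-antisym; ≤-total; +-mono; +-comm; +-assoc)
  open Tropical RR

  ≤T-refl : ∀ x → x ≤T x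
  ≤T-refl (fin a) = fin≤fin (≤-refl a)
  ≤T-refl ∞       = ∞ ≤∞

  ≤T-trans : ∀ {x y z} → x ≤T y → y ≤T z → x ≤T z
  ≤T-trans (fin≤fin p) (fin≤fin q) = fin≤fin (≤-trans p q)
  ≤T-trans {x} _       (_ ≤∞)      = x ≤∞

  ≤T-antisym : ∀ {x y} → x ≤T y → y ≤T x → x ≡ y
  ≤T-antisym (fin≤fin p) (fin≤fin q) = cong fin (≤-antisym p q)
  ≤T-antisym (_ ≤∞)      (_ ≤∞)      = refl

  ≤T-total : ∀ x y → x ≤T y ⊎ y ≤T x
  ≤T-total (fin a) (fin b) with ≤-total a b
  ... | inj₁ a≤b = inj₁ (fin≤fin a≤b)
  ... | inj₂ b≤a = inj₂ (fin≤fin b≤a)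
  ≤T-total x ∞ = inj₁ (x ≤∞)
  ≤T-total ∞ y = inj₂ (y ≤∞)

  ⊕-lowerˡ : ∀ x y → x ⊕ y ≤T x
  ⊕-lowerˡ (fin a) (fin b) with ≤-total a b
  ... | inj₁ _   = ≤T-refl (fin a)
  ... | inj₂ b≤a = fin≤fin b≤a
  ⊕-lowerˡ (fin a) ∞ = ≤T-refl (fin a)
  ⊕-lowerˡ ∞       y = y ≤∞

  ⊕-lowerʳ : ∀ x y → x ⊕ y ≤T y
  ⊕-lowerʳ (fin a) (fin b) with ≤-total a b
  ... | inj₁ a≤b = fin≤fin a≤b
  ... | inj₂ _   = ≤T-refl (fin b)
  ⊕-lowerʳ (fin a) ∞ = fin a ≤∞
  ⊕-lowerʳ ∞       y = ≤T-refl y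

  ⊕-greatest : ∀ {t} x y → t ≤T x → t ≤T y → t ≤T x ⊕ y
  ⊕-greatest (fin a) (fin b) t≤x t≤y with ≤-total a b
  ... | inj₁ _ = t≤x
  ... | inj₂ _ = t≤y
  ⊕-greatest (fin a) ∞ t≤x _   = t≤x
  ⊕-greatest ∞       y _   t≤y = t≤y

  x≤y⇒x⊕y≡x : ∀ {x y} → x ≤T y → x ⊕ y ≡ x
  x≤y⇒x⊕y≡x {x} {y} x≤y = ≤T-antisym (⊕-lowerˡ x y) (⊕-greatest x y (≤T-refl x) x≤y)

  y≤x⇒x⊕y≡y : ∀ {x y} → y ≤T x → x ⊕ y ≡ y
  y≤x⇒x⊕y≡y {x} {y} y≤x = ≤T-antisym (⊕-lowerʳ x y) (⊕-greatest x y y≤x (≤T-refl y))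

  ⊕-comm : ∀ x y → x ⊕ y ≡ y ⊕ x
  ⊕-comm x y = ≤T-antisym (⊕-greatest y x (⊕-lowerʳ x y) (⊕-lowerˡ x y))
                          (⊕-greatest x y (⊕-lowerʳ y x) (⊕-lowerˡ y x))

  ⊕-assoc : ∀ x y z → (x ⊕ y) ⊕ z ≡ x ⊕ (y ⊕ z)
  ⊕-assoc x y z = ≤T-antisym
    (⊕-greatest x (y ⊕ z) (≤T-trans (⊕-lowerˡ (x ⊕ y) z) (⊕-lowerˡ x y))
      (⊕-greatest y z (≤T-trans (⊕-lowerˡ (x ⊕ y) z) (⊕-lowerʳ x y)) (⊕-lowerʳ (x ⊕ y) z)))
    (⊕-greatest (x ⊕ y) z
      (⊕-greatest x y (⊕-lowerˡ x (y ⊕ z)) (≤T-trans (⊕-lowerʳ x (y ⊕ z)) (⊕-lowerˡ y z)))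
      (≤T-trans (⊕-lowerʳ x (y ⊕ z)) (⊕-lowerʳ y z)))

  ⊕-identityʳ : ∀ x → x ⊕ ∞ ≡ x
  ⊕-identityʳ (fin a) = refl
  ⊕-identityʳ ∞       = refl

  ⊙-comm : ∀ x y → x ⊙ y ≡ y ⊙ x
  ⊙-comm (fin a) (fin b) = cong fin (+-comm a b)
  ⊙-comm (fin a) ∞       = refl
  ⊙-comm ∞       (fin b) = refl
  ⊙-comm ∞       ∞       = refl

  ⊙-assoc : ∀ x y z → (x ⊙ y) ⊙ z ≡ x ⊙ (y ⊙ z)
  ⊙-assoc (fin a) (fin b) (fin c) = cong fin (+-assoc a b c)
  ⊙-assoc (fin a) (fin b) ∞       = refl
  ⊙-assoc (fin a) ∞       z       = refl
  ⊙-assoc ∞       y       z       = refl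

  ⊙-zeroʳ : ∀ t → t ⊙ ∞ ≡ ∞
  ⊙-zeroʳ (fin a) = refl
  ⊙-zeroʳ ∞       = refl

  ⊙-monoˡ : ∀ t {x y} → x ≤T y → x ⊙ t ≤T y ⊙ t
  ⊙-monoˡ (fin c) (fin≤fin a≤b) = fin≤fin (+-mono c a≤b)
  ⊙-monoˡ ∞       (fin≤fin _)   = ∞ ≤∞
  ⊙-monoˡ t       (x ≤∞)        = (x ⊙ t) ≤∞

  ⊙-monoʳ : ∀ t {x y} → x ≤T y → t ⊙ x ≤T t ⊙ y
  ⊙-monoʳ t {x} {y} x≤y = subst₂ _≤T_ (⊙-comm x t) (⊙-comm y t) (⊙-monoˡ t x≤y)

  ⊙-distribˡ-⊕ : ∀ t x y → t ⊙ (x ⊕ y) ≡ t ⊙ x ⊕ t ⊙ y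
  ⊙-distribˡ-⊕ t x y with ≤T-total x y
  ... | inj₁ x≤y = trans (cong (t ⊙_) (x≤y⇒x⊕y≡x x≤y)) (sym (x≤y⇒x⊕y≡x (⊙-monoʳ t x≤y)))
  ... | inj₂ y≤x = trans (cong (t ⊙_) (y≤x⇒x⊕y≡y y≤x)) (sym (y≤x⇒x⊕y≡y (⊙-monoʳ t y≤x)))

  ⊕-commutativeSemigroup : CommutativeSemigroup _ _
  ⊕-commutativeSemigroup = record
    { _≈_ = _≡_
    ; _∙_ = _⊕_
    ; isCommutativeSemigroup = record
      { isSemigroup = record
        { isMagma = record { isEquivalence = isEquivalence ; ∙-cong = cong₂ _⊕_ }
        ; assoc = ⊕-assoc }
      ; comm = ⊕-comm } }

  ⊙-commutativeSemigroup : CommutativeSemigroup _ _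
  ⊙-commutativeSemigroup = record
    { _≈_ = _≡_
    ; _∙_ = _⊙_
    ; isCommutativeSemigroup = record
      { isSemigroup = record
        { isMagma = record { isEquivalence = isEquivalence ; ∙-cong = cong₂ _⊙_ }
        ; assoc = ⊙-assoc }
      ; comm = ⊙-comm } }

  open CommutativeSemigroupProperties ⊕-commutativeSemigroup
    using () renaming (interchange to ⊕-interchange)
  open CommutativeSemigroupProperties ⊙-commutativeSemigroup
    using () renaming (x∙yz≈y∙xz to ⊙-swap)

  ⨁-cong : ∀ n {f g : Fin n → 𝕋} → (∀ j → f j ≡ g j) → ⨁ n f ≡ ⨁ n g
  ⨁-cong zero    f≡g = refl
  ⨁-cong (suc n) f≡g = cong₂ _⊕_ (f≡g Fin.zero) (⨁-cong n (λ j → f≡g (Fin.suc j)))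

  ⨁-distrib-⊕ : ∀ n (f g : Fin n → 𝕋) → ⨁ n (λ j → f j ⊕ g j) ≡ ⨁ n f ⊕ ⨁ n g
  ⨁-distrib-⊕ zero    f g = refl
  ⨁-distrib-⊕ (suc n) f g = begin
    (f₀ ⊕ g₀) ⊕ ⨁ n (λ j → f (Fin.suc j) ⊕ g (Fin.suc j))
      ≡⟨ cong ((f₀ ⊕ g₀) ⊕_) (⨁-distrib-⊕ n (λ j → f (Fin.suc j)) (λ j → g (Fin.suc j))) ⟩
    (f₀ ⊕ g₀) ⊕ (⨁ n (λ j → f (Fin.suc j)) ⊕ ⨁ n (λ j → g (Fin.suc j)))
      ≡⟨ ⊕-interchange f₀ g₀ _ _ ⟩
    ⨁ (suc n) f ⊕ ⨁ (suc n) g ∎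
    where
    open ≡-Reasoning
    f₀ g₀ : 𝕋
    f₀ = f Fin.zero
    g₀ = g Fin.zero

  ⨁-distrib-⊙ : ∀ n t (f : Fin n → 𝕋) → ⨁ n (λ j → t ⊙ f j) ≡ t ⊙ ⨁ n f
  ⨁-distrib-⊙ zero    t f = sym (⊙-zeroʳ t)
  ⨁-distrib-⊙ (suc n) t f =
    trans (cong (t ⊙ f Fin.zero ⊕_) (⨁-distrib-⊙ n t (λ j → f (Fin.suc j))))
          (sym (⊙-distribˡ-⊕ t (f Fin.zero) (⨁ n (λ j → f (Fin.suc j)))))

  ⊙-distrib-linear : ∀ c s t x y → c ⊙ (s ⊙ x ⊕ t ⊙ y) ≡ s ⊙ (c ⊙ x) ⊕ t ⊙ (c ⊙ y)
  ⊙-distrib-linear c s t x y =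
    trans (⊙-distribˡ-⊕ c (s ⊙ x) (t ⊙ y)) (cong₂ _⊕_ (⊙-swap c s x) (⊙-swap c t y))

  ⊙ᴹ-linear : ∀ {m n} (B : Fin m → Fin n → 𝕋) (s t : 𝕋) (x y : Fin n → 𝕋) i →
              (B ⊙ᴹ (λ k → s ⊙ x k ⊕ t ⊙ y k)) i ≡ s ⊙ (B ⊙ᴹ x) i ⊕ t ⊙ (B ⊙ᴹ y) i
  ⊙ᴹ-linear {n = n} B s t x y i = begin
    ⨁ n (λ j → B i j ⊙ (s ⊙ x j ⊕ t ⊙ y j))
      ≡⟨ ⨁-cong n (λ j → ⊙-distrib-linear (B i j) s t (x j) (y j)) ⟩
    ⨁ n (λ j → s ⊙ (B i j ⊙ x j) ⊕ t ⊙ (B i j ⊙ y j))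
      ≡⟨ ⨁-distrib-⊕ n _ _ ⟩
    ⨁ n (λ j → s ⊙ (B i j ⊙ x j)) ⊕ ⨁ n (λ j → t ⊙ (B i j ⊙ y j))
      ≡⟨ cong₂ _⊕_ (⨁-distrib-⊙ n s _) (⨁-distrib-⊙ n t _) ⟩
    s ⊙ (B ⊙ᴹ x) i ⊕ t ⊙ (B ⊙ᴹ y) i ∎
    where open ≡-Reasoning

  MinTwiceOrInf-cong : ∀ {n} {u v : Fin n → 𝕋} → (∀ k → u k ≡ v k) →
                       MinTwiceOrInf u → MinTwiceOrInf v
  MinTwiceOrInf-cong {u = u} {v} u≡v (inj₁ (i , j , i≢j , uᵢ≡uⱼ , uᵢ-min)) =
    inj₁ (i , j , i≢j , trans (sym (u≡v i)) (trans uᵢ≡uⱼ (u≡v j)) ,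
          λ k → subst₂ _≤T_ (u≡v i) (u≡v k) (uᵢ-min k))
  MinTwiceOrInf-cong u≡v (inj₂ u≡∞) = inj₂ (λ k → trans (sym (u≡v k)) (u≡∞ k))

  MinTwiceOrInf-scale : ∀ {n} t {u : Fin n → 𝕋} → MinTwiceOrInf u →
                        MinTwiceOrInf (λ k → t ⊙ u k)
  MinTwiceOrInf-scale t (inj₁ (i , j , i≢j , uᵢ≡uⱼ , uᵢ-min)) =
    inj₁ (i , j , i≢j , cong (t ⊙_) uᵢ≡uⱼ , λ k → ⊙-monoʳ t (uᵢ-min k))
  MinTwiceOrInf-scale t (inj₂ u≡∞) = inj₂ (λ k → trans (cong (t ⊙_) (u≡∞ k)) (⊙-zeroʳ t))

  minTwice-⊕-dominated : ∀ {n} {u w : Fin n → 𝕋} {i j} → ¬ i ≡ j → u i ≡ u j →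
                         (∀ k → u i ≤T u k) → (∀ k → u i ≤T w k) →
                         MinTwiceOrInf (λ k → u k ⊕ w k)
  minTwice-⊕-dominated {u = u} {w} {i} {j} i≢j uᵢ≡uⱼ uᵢ-min uᵢ≤w =
    inj₁ (i , j , i≢j , trans (at-min i refl) (trans uᵢ≡uⱼ (sym (at-min j uᵢ≡uⱼ))) ,
          λ k → subst₂ _≤T_ (sym (at-min i refl)) refl
                       (⊕-greatest (u k) (w k) (uᵢ-min k) (uᵢ≤w k)))
    where
    at-min : ∀ l → u i ≡ u l → u l ⊕ w l ≡ u l
    at-min l uᵢ≡uₗ = x≤y⇒x⊕y≡x (subst₂ _≤T_ uᵢ≡uₗ refl (uᵢ≤w l))

  MinTwiceOrInf-⊕ : ∀ {n} {u w : Fin n → 𝕋} → MinTwiceOrInf u → MinTwiceOrInf w →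
                    MinTwiceOrInf (λ k → u k ⊕ w k)
  MinTwiceOrInf-⊕ (inj₂ u≡∞) w-min = MinTwiceOrInf-cong (λ k → sym (cong (_⊕ _) (u≡∞ k))) w-min
  MinTwiceOrInf-⊕ {u = u} u-min (inj₂ w≡∞) =
    MinTwiceOrInf-cong (λ k → trans (sym (⊕-identityʳ (u k))) (cong (u k ⊕_) (sym (w≡∞ k)))) u-min
  MinTwiceOrInf-⊕ {u = u} {w} (inj₁ (i , j , i≢j , uᵢ≡uⱼ , uᵢ-min))
                              (inj₁ (i' , j' , i'≢j' , wᵢ'≡wⱼ' , wᵢ'-min))
    with ≤T-total (u i) (w i')
  ... | inj₁ uᵢ≤wᵢ' =
    minTwice-⊕-dominated i≢j uᵢ≡uⱼ uᵢ-min (λ k → ≤T-trans uᵢ≤wᵢ' (wᵢ'-min k))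
  ... | inj₂ wᵢ'≤uᵢ = MinTwiceOrInf-cong (λ k → ⊕-comm (w k) (u k))
    (minTwice-⊕-dominated i'≢j' wᵢ'≡wⱼ' wᵢ'-min (λ k → ≤T-trans wᵢ'≤uᵢ (uᵢ-min k)))

  fin-⊕-finite : ∀ a t → ∃ λ b → fin a ⊕ t ≡ fin b
  fin-⊕-finite a (fin c) with ≤-total a c
  ... | inj₁ _ = a , refl
  ... | inj₂ _ = c , refl
  fin-⊕-finite a ∞ = a , refl

  combination : ∀ {n} → ℝ → (Fin n → 𝕋) → ℝ → (Fin n → 𝕋) → Fin n → 𝕋
  combination lam x rho y k = fin lam ⊙ x k ⊕ fin rho ⊙ y k

  InTrop-convex : ∀ {n r} (M : ValuatedMatroid n r) {x y : Fin n → 𝕋} (lam rho : ℝ) →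
                  InTrop M x → InTrop M y → InTrop M (combination lam x rho y)
  InTrop-convex {r = r} M {x} {y} lam rho ((i , a , xᵢ≡a) , x-circuits) (_ , y-circuits) =
    combination-finite , combination-circuits
    where
    open ValuatedMatroid M
    combination-finite : NotAllInfinite (combination lam x rho y)
    combination-finite with fin-⊕-finite (Reals._+_ RR lam a) (fin rho ⊙ y i)
    ... | b , eq = i , b , trans (cong (λ xᵢ → fin lam ⊙ xᵢ ⊕ fin rho ⊙ y i) xᵢ≡a) eq
    combination-circuits : ∀ I → ∣ I ∣ ≡ suc r → NotAllInfinite (circuitVec μ I) →
                           MinTwiceOrInf (λ k → circuitVec μ I k ⊙ combination lam x rho y k)
    combination-circuits I size C≢∞ = MinTwiceOrInf-cong
      (λ k → sym (⊙-distrib-linear (circuitVec μ I k) (fin lam) (fin rho) (x k) (y k)))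
      (MinTwiceOrInf-⊕ (MinTwiceOrInf-scale (fin lam) (x-circuits I size C≢∞))
                       (MinTwiceOrInf-scale (fin rho) (y-circuits I size C≢∞)))

mainTheorem4 : (RR : Reals) → let open Tropical RR in
    ∀ {c ℓ} (K : Field c ℓ) (V : Valuation RR K)
      (n r m : ℕ) (M : ValuatedMatroid n r)
      (A : Fin m → Fin n → Field.Carrier K) →
    let valA : Fin m → Fin n → 𝕋
        valA i j = Valuation.val V (A i j)
    in ∀ (v w : Fin m → 𝕋) →
       (∃ λ x → InTrop M x × (∀ i → v i ≡ (valA ⊙ᴹ x) i)) →
       (∃ λ y → InTrop M y × (∀ i → w i ≡ (valA ⊙ᴹ y) i)) →
       ∀ (lam rho : Reals.ℝ RR) →
       ∃ λ z → InTrop M z ×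
         (∀ i → (valA ⊙ᴹ z) i ≡ (fin lam ⊙ v i) ⊕ (fin rho ⊙ w i))
mainTheorem4 RR K V n r m M A v w (x , x∈trop , v≡Ax) (y , y∈trop , w≡Ay) lam rho =
  combination lam x rho y , InTrop-convex M lam rho x∈trop y∈trop , image
  where
  open Tropical RR
  open TropicalProperties RR
  valA : Fin m → Fin n → 𝕋
  valA i j = Valuation.val V (A i j)
  image : ∀ i → (valA ⊙ᴹ combination lam x rho y) i ≡ fin lam ⊙ v i ⊕ fin rho ⊙ w i
  image i = trans (⊙ᴹ-linear valA (fin lam) (fin rho) x y i)
                  (sym (cong₂ (λ vᵢ wᵢ → fin lam ⊙ vᵢ ⊕ fin rho ⊙ wᵢ) (v≡Ax i) (w≡Ay i)))
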